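{- Let $n\geq 2$ and let $\pi(n)$ be a finite projective plane of order $n$ with point set $\{1,\ldots,n^2+n+1\}$ and lines $l_1,\ldots,l_{n^2+n+1}$. Let $r_1\geq r_2\geq\cdots\geq r_{n^2+n+1}\geq 1$ be integers. If $\sum_{i=n+2}^{n^2+n+1} r_i>2(n+1)$, then $Erd(r_1,\ldots,r_{n^2+n+1})\notin\mathfrak{N}$.
   Context: All graphs are finite, without loops or multiple edges. An interval $t$-coloring of a graph $G$ is a proper edge-coloring of $G$ with colors $1,\ldots,t$ such that every color is used and for every vertex $v$ the set of colors of edges incident to $v$ is an interval of integers. $\mathfrak{N}$ denotes the set of graphs having an interval $t$-coloring for some positive integer $t$. A finite projective plane of order $n$ has $n^2+n+1$ points and $n^2+n+1$ lines, any two points lie on a unique common line, any two lines meet in a unique point, every point is on $n+1$ lines and every line contains $n+1$ points. Given such a plane with lines $l_1,\ldots,l_{n^2+n+1}$ and integers $r_1\geq\cdots\geq r_{n^2+n+1}\geq1$, the graph $Erd(r_1,\ldots,r_{n^2+n+1})$ has vertex set $\{u\}\cup\{1,\ldots,n^2+n+1\}\cup\{v^{(l_i)}_1,\ldots,v^{(l_i)}_{r_i}:1\leq i\leq n^2+n+1\}$ and edges $uv^{(l_i)}_p$ for all $i$ and $1\leq p\leq r_i$, together with edges $v^{(l_i)}_p k$ for all $i$, $1\leq p\leq r_i$ and every point $k$ on the line $l_i$. It is a connected bipartite graph with maximum degree $\sum_i r_i$. -}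

module Defs where

open import Data.Nat using (ℕ; zero; suc; _+_; _*_; _≤_; _≤?_)
open import Data.Fin using (Fin; toℕ)
open import Data.Bool using (Bool; true; false; T; _∧_)
open import Data.List using (List; length; filter; map)
open import Data.Nat.ListAction using (sum)
open import Data.List using (allFin)
open import Data.Product using (Σ; Σ-syntax; ∃; ∃-syntax; _×_; _,_)
open import Relation.Binary.PropositionalEquality using (_≡_; _≢_)
open import Relation.Nullary using (¬_)
open import Relation.Nullary.Decidable using (T?)

record Graph : Set₁ where
  field
    Vertex : Set
    adj    : Vertex → Vertex → Bool
    adj-sym   : ∀ u v → adj u v ≡ adj v u
    adj-irrefl : ∀ v → adj v v ≡ false

open Graph public

-- An edge-colouring assigns to every ordered pair of vertices a number;
-- only the values on edges matter.  An interval t-colouring: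
record IntervalColoring (G : Graph) (t : ℕ) : Set where
  field
    col : Vertex G → Vertex G → ℕ
    col-sym : ∀ u v → T (adj G u v) → col u v ≡ col v u
    col-range : ∀ u v → T (adj G u v) → 1 ≤ col u v × col u v ≤ t
    proper : ∀ v w w′ → T (adj G v w) → T (adj G v w′) → w ≢ w′ →
             col v w ≢ col v w′
    surjective : ∀ k → 1 ≤ k → k ≤ t →
                 ∃[ u ] ∃[ v ] (T (adj G u v) × col u v ≡ k)
    interval : ∀ v w w′ k → T (adj G v w) → T (adj G v w′) →
               col v w ≤ k → k ≤ col v w′ →
               ∃[ x ] (T (adj G v x) × col v x ≡ k)

InN : Graph → Set
InN G = ∃[ t ] (1 ≤ t × IntervalColoring G t)

-- Finite projective planes of order n on points Fin N, lines Fin N,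
-- N = n² + n + 1.  incid k i = true  iff point k lies on line l_i.

PPsize : ℕ → ℕ
PPsize n = n * n + n + 1

countTrue : ∀ {N} → (Fin N → Bool) → ℕ
countTrue {N} f = length (filter (λ k → T? (f k)) (allFin N))

record ProjectivePlane (n : ℕ) : Set where
  field
    incid : Fin (PPsize n) → Fin (PPsize n) → Bool
    two-points : ∀ p q → p ≢ q →
      Σ[ l ∈ Fin (PPsize n) ] (T (incid p l) × T (incid q l) ×
        (∀ l′ → T (incid p l′) → T (incid q l′) → l′ ≡ l))
    two-lines : ∀ l m → l ≢ m →
      Σ[ p ∈ Fin (PPsize n) ] (T (incid p l) × T (incid p m) ×
        (∀ p′ → T (incid p′ l) → T (incid p′ m) → p′ ≡ p))
    point-deg : ∀ p → countTrue (λ l → incid p l) ≡ suc n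
    line-deg : ∀ l → countTrue (λ p → incid p l) ≡ suc n

open ProjectivePlane public

data ErdV (N : ℕ) (r : Fin N → ℕ) : Set where
  u   : ErdV N r
  pt  : Fin N → ErdV N r
  vtx : (i : Fin N) → Fin (r i) → ErdV N r

module _ {n : ℕ} (P : ProjectivePlane n) (r : Fin (PPsize n) → ℕ) where

  erdAdj : ErdV (PPsize n) r → ErdV (PPsize n) r → Bool
  erdAdj u (vtx i p) = true
  erdAdj (vtx i p) u = true
  erdAdj (vtx i p) (pt k) = incid P k i
  erdAdj (pt k) (vtx i p) = incid P k i
  erdAdj u u = false
  erdAdj u (pt k) = false
  erdAdj (pt k) u = false
  erdAdj (pt k) (pt k′) = false
  erdAdj (vtx i p) (vtx j q) = false

  erdAdj-sym : ∀ a b → erdAdj a b ≡ erdAdj b a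
  erdAdj-sym u u = _≡_.refl
  erdAdj-sym u (pt k) = _≡_.refl
  erdAdj-sym u (vtx i p) = _≡_.refl
  erdAdj-sym (pt k) u = _≡_.refl
  erdAdj-sym (pt k) (pt k′) = _≡_.refl
  erdAdj-sym (pt k) (vtx i p) = _≡_.refl
  erdAdj-sym (vtx i p) u = _≡_.refl
  erdAdj-sym (vtx i p) (pt k) = _≡_.refl
  erdAdj-sym (vtx i p) (vtx j q) = _≡_.refl

  erdAdj-irrefl : ∀ a → erdAdj a a ≡ false
  erdAdj-irrefl u = _≡_.refl
  erdAdj-irrefl (pt k) = _≡_.refl
  erdAdj-irrefl (vtx i p) = _≡_.refl

  Erd : Graph
  Erd = record
    { Vertex = ErdV (PPsize n) r
    ; adj = erdAdj
    ; adj-sym = erdAdj-sym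
    ; adj-irrefl = erdAdj-irrefl
    }

-- ∑_{i = n+2}^{N} r_i  (1-indexed), i.e. over 0-based indices i with n+1 ≤ i.
tailSum : (n : ℕ) → (Fin (PPsize n) → ℕ) → ℕ
tailSum n r = sum (map r (filter (λ i → suc n ≤? toℕ i) (allFin (PPsize n))))

module Submission where

-- Idea of the proof.  Suppose Erd(r) has an interval colouring and let
-- D = r₁ + ⋯ + r_N be the degree of the vertex u.
--
--  * At any vertex x of any graph, if all neighbours of x occur in a list
--    of length d, then any two colours at x differ by less than d
--    (the colours at x form an interval of at most d integers).
--  * For two neighbours v ∈ l_i, v′ ∈ l_{i′} of u, pick a point k on both
--    lines.  Walking u – v – k – v′ – u through vertices of degree n+2,
--    deg k, n+2 shows that the colours of uv and uv′ differ by less than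
--    deg k + 2(n+1).  Since k lies on n+1 lines and r is non-increasing,
--    deg k ≤ H := r₁ + ⋯ + r_{n+1}.
--  * The D colours at u are distinct, so they cannot all lie in a window
--    of width H + 2(n+1); hence D ≤ H + 2(n+1).  But D = H + tailSum,
--    and tailSum > 2(n+1) by hypothesis: contradiction.

open import Defs
open import Data.Nat using (ℕ; zero; suc; _≤_; _<_; _>_; _+_; _*_; _∸_; z≤n; s≤s; s≤s⁻¹; _≤?_)
open import Data.Nat.Properties
open import Data.Nat.ListAction using (sum)
open import Data.Nat.Solver using (module +-*-Solver)
open import Data.Fin using (Fin; toℕ; splitAt; _↑ˡ_; _↑ʳ_; fromℕ<)
  renaming (_≤_ to _≤ᶠ_; zero to fzero; suc to fsuc)
import Data.Fin.Properties as FinP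
open import Data.Bool using (Bool; true; false; T; if_then_else_)
open import Data.Unit using (tt)
open import Data.Sum using (inj₁; inj₂)
open import Data.Product using (Σ; ∃-syntax; _×_; _,_; proj₁; proj₂)
open import Data.List using (List; []; _∷_; length; filter; map; allFin; tabulate; concatMap; lookup)
open import Data.List.Properties using (length-map; length-++; length-tabulate; map-tabulate; map-cong)
open import Data.List.Membership.Propositional using (_∈_)
open import Data.List.Membership.Propositional.Properties
  using (∈-map⁺; ∈-filter⁺; ∈-filter⁻; ∈-allFin; ∈-concatMap⁺)
import Data.List.Relation.Unary.Any as Any
open import Data.List.Relation.Unary.Any.Properties using (lookup-index)
import Data.List.Relation.Unary.All as All
open import Data.List.Extrema.Nat using (argmin; f[argmin]≤f[xs])
open import Algebra.Properties.Monoid.Sum +-0-monoid using (sum-syntax; sum-cong-≗)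
open import Function using (_∘_; id)
open import Function.Definitions using (Injective)
open import Relation.Binary.PropositionalEquality
open import Relation.Nullary using (¬_; does; yes; no; contradiction)
open import Relation.Nullary.Decidable using (T?)
open import Relation.Unary using (Pred; Decidable)

weight : Bool → ℕ → ℕ
weight b x = if b then x else 0

prefixSum : ∀ {N} → ℕ → (Fin N → ℕ) → ℕ
prefixSum {N}     zero    r = 0
prefixSum {zero}  (suc m) r = 0
prefixSum {suc N} (suc m) r = r fzero + prefixSum m (r ∘ fsuc)

suc≤?suc : ∀ m x → does (suc m ≤? suc x) ≡ does (m ≤? x)
suc≤?suc zero    x = refl
suc≤?suc (suc m) x = refl

∑-split : ∀ {N} m (r : Fin N → ℕ) →
  ∑[ i < N ] r i ≡ prefixSum m r + ∑[ i < N ] weight (does (m ≤? toℕ i)) (r i)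
∑-split         zero    r = refl
∑-split {zero}  (suc m) r = refl
∑-split {suc N} (suc m) r = begin
  r₀ + ∑[ i < N ] r (fsuc i)
    ≡⟨ cong (r₀ +_) (∑-split m (r ∘ fsuc)) ⟩
  r₀ + (prefixSum m (r ∘ fsuc) + ∑[ i < N ] weight (does (m ≤? toℕ i)) (r (fsuc i)))
    ≡⟨ sym (+-assoc r₀ _ _) ⟩
  prefixSum (suc m) r + ∑[ i < N ] weight (does (m ≤? toℕ i)) (r (fsuc i))
    ≡⟨ cong (prefixSum (suc m) r +_) (sum-cong-≗ λ i →
         cong (λ b → weight b (r (fsuc i))) (sym (suc≤?suc m (toℕ i)))) ⟩
  prefixSum (suc m) r + ∑[ i < suc N ] weight (does (suc m ≤? toℕ i)) (r i) ∎
  where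
  open ≡-Reasoning
  r₀ : ℕ
  r₀ = r fzero

sum-filter : ∀ {A : Set} {ℓ} {P : Pred A ℓ} (P? : Decidable P) (g : A → ℕ) xs →
  sum (map g (filter P? xs)) ≡ sum (map (λ x → weight (does (P? x)) (g x)) xs)
sum-filter P? g []       = refl
sum-filter P? g (x ∷ xs) with does (P? x)
... | true  = cong (g x +_) (sum-filter P? g xs)
... | false = sum-filter P? g xs

sum-allFin : ∀ N (g : Fin N → ℕ) → sum (map g (allFin N)) ≡ ∑[ i < N ] g i
sum-allFin N g = trans (cong sum (map-tabulate id g)) (sum-tabulate N g)
  where
  sum-tabulate : ∀ N (g : Fin N → ℕ) → sum (tabulate g) ≡ ∑[ i < N ] g i
  sum-tabulate zero    g = refl
  sum-tabulate (suc N) g = cong (g fzero +_) (sum-tabulate N (g ∘ fsuc))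

sum-filter-allFin : ∀ {N} {ℓ} {P : Pred (Fin N) ℓ} (P? : Decidable P) (g : Fin N → ℕ) →
  sum (map g (filter P? (allFin N))) ≡ ∑[ i < N ] weight (does (P? i)) (g i)
sum-filter-allFin {N} P? g = trans (sum-filter P? g (allFin N)) (sum-allFin N _)

length-as-sum : ∀ {A : Set} (xs : List A) → length xs ≡ sum (map (λ _ → 1) xs)
length-as-sum []       = refl
length-as-sum (x ∷ xs) = cong suc (length-as-sum xs)

length-concatMap : ∀ {A B : Set} (f : A → List B) xs →
  length (concatMap f xs) ≡ sum (map (length ∘ f) xs)
length-concatMap f []       = refl
length-concatMap f (x ∷ xs) =
  trans (length-++ (f x)) (cong (length (f x) +_) (length-concatMap f xs))

Nonincreasing : ∀ {N} → (Fin N → ℕ) → Set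
Nonincreasing {N} r = ∀ (i j : Fin N) → toℕ i ≤ toℕ j → r j ≤ r i

module _ {N} {r : Fin (suc N) → ℕ} (dec : Nonincreasing r) where

  tail-nonincreasing : Nonincreasing (r ∘ fsuc)
  tail-nonincreasing i j i≤j = dec (fsuc i) (fsuc j) (s≤s i≤j)

  head-largest : ∀ i → r (fsuc i) ≤ r fzero
  head-largest i = dec fzero (fsuc i) z≤n

prefixSum-shift : ∀ {N} m (s : Fin N → ℕ) x → Nonincreasing s → (∀ i → s i ≤ x) →
  prefixSum (suc m) s ≤ x + prefixSum m s
prefixSum-shift {zero}  m       s x dec bound = z≤n
prefixSum-shift {suc N} zero    s x dec bound = +-monoˡ-≤ 0 (bound fzero)
prefixSum-shift {suc N} (suc m) s x dec bound =
  ≤-trans (+-monoʳ-≤ s₀ (prefixSum-shift m (s ∘ fsuc) s₀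
            (tail-nonincreasing dec) (head-largest dec)))
          (+-monoˡ-≤ _ (bound fzero))
  where
  s₀ : ℕ
  s₀ = s fzero

selected≤prefixSum : ∀ {N} m (r : Fin N → ℕ) (b : Fin N → Bool) → Nonincreasing r →
  ∑[ i < N ] weight (b i) 1 ≤ m → ∑[ i < N ] weight (b i) (r i) ≤ prefixSum m r
selected≤prefixSum {zero}  m r b dec count = z≤n
selected≤prefixSum {suc N} m r b dec count with b fzero
selected≤prefixSum {suc N} (suc m) r b dec count | true =
  +-monoʳ-≤ (r fzero)
    (selected≤prefixSum m (r ∘ fsuc) (b ∘ fsuc) (tail-nonincreasing dec) (s≤s⁻¹ count))
selected≤prefixSum {suc N} zero    r b dec count | false =
  selected≤prefixSum zero (r ∘ fsuc) (b ∘ fsuc) (tail-nonincreasing dec) count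
selected≤prefixSum {suc N} (suc m) r b dec count | false =
  ≤-trans (selected≤prefixSum (suc m) (r ∘ fsuc) (b ∘ fsuc) (tail-nonincreasing dec) count)
          (prefixSum-shift m (r ∘ fsuc) (r fzero) (tail-nonincreasing dec) (head-largest dec))

injective-into-list : ∀ {A : Set} {m} (ns : List A) (g : Fin m → A) →
  Injective _≡_ _≡_ g → (∀ j → g j ∈ ns) → m ≤ length ns
injective-into-list {m = m} ns g g-inj g∈ns = FinP.injective⇒≤ position-injective
  where
  position : Fin m → Fin (length ns)
  position j = Any.index (g∈ns j)

  position-injective : Injective _≡_ _≡_ position
  position-injective {j} {j′} eq = g-inj (begin
    g j                     ≡⟨ lookup-index (g∈ns j) ⟩
    lookup ns (position j)  ≡⟨ cong (lookup ns) eq ⟩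
    lookup ns (position j′) ≡⟨ lookup-index (g∈ns j′) ⟨
    g j′                    ∎)
    where open ≡-Reasoning

-- D distinct numbers, any two of which differ by less than m, number at
-- most m: shifted by their minimum they inject into Fin m.
injective-width : ∀ {D} m (c : Fin D → ℕ) → Injective _≡_ _≡_ c →
  (∀ j j′ → c j′ < c j + m) → D ≤ m
injective-width {zero}  m c c-inj close = z≤n
injective-width {suc D} m c c-inj close = FinP.injective⇒≤ shift-injective
  where
  j₀ : Fin (suc D)
  j₀ = argmin c fzero (allFin (suc D))

  a : ℕ
  a = c j₀

  a≤ : ∀ j → a ≤ c j
  a≤ j = All.lookup (f[argmin]≤f[xs] {f = c} fzero (allFin (suc D))) (∈-allFin j)

  shift< : ∀ j → c j ∸ a < m
  shift< j = +-cancelˡ-< a _ _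
    (subst (_< a + m) (sym (m+[n∸m]≡n (a≤ j))) (close j₀ j))

  shift : Fin (suc D) → Fin m
  shift j = fromℕ< (shift< j)

  shift-injective : Injective _≡_ _≡_ shift
  shift-injective {j} {j′} eq = c-inj (∸-cancelʳ-≡ (a≤ j) (a≤ j′) (begin
    c j ∸ a          ≡⟨ FinP.toℕ-fromℕ< (shift< j) ⟨
    toℕ (shift j)    ≡⟨ cong toℕ eq ⟩
    toℕ (shift j′)   ≡⟨ FinP.toℕ-fromℕ< (shift< j′) ⟩
    c j′ ∸ a         ∎))
    where open ≡-Reasoning

module _ {G : Graph} {t : ℕ} (C : IntervalColoring G t) where
  open IntervalColoring C

  -- If every neighbour of x occurs in ns, then the colours at x lie in a
  -- window of width length ns: every colour between two colours at x is
  -- realised at x, by distinct neighbours.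
  colour-window : ∀ x (ns : List (Vertex G)) → (∀ y → T (adj G x y) → y ∈ ns) →
    ∀ w w′ → T (adj G x w) → T (adj G x w′) → col x w′ < col x w + length ns
  colour-window x ns cover w w′ xw xw′ with col x w ≤? col x w′
  ... | no  w≰w′ = <-≤-trans (≰⇒> w≰w′) (m≤m+n _ _)
  ... | yes w≤w′ = subst (_< a + length ns) (m+[n∸m]≡n w≤w′)
                     (+-monoʳ-< a (injective-into-list ns g g-injective g∈ns))
    where
    a d : ℕ
    a = col x w
    d = col x w′ ∸ a

    realised : (j : Fin (suc d)) → ∃[ y ] (T (adj G x y) × col x y ≡ a + toℕ j)
    realised j = interval x w w′ (a + toℕ j) xw xw′ (m≤m+n a _)
      (subst (a + toℕ j ≤_) (m+[n∸m]≡n w≤w′) (+-monoʳ-≤ a (s≤s⁻¹ (FinP.toℕ<n j))))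

    g : Fin (suc d) → Vertex G
    g j = proj₁ (realised j)

    g∈ns : ∀ j → g j ∈ ns
    g∈ns j = cover (g j) (proj₁ (proj₂ (realised j)))

    g-injective : Injective _≡_ _≡_ g
    g-injective {j} {j′} eq = FinP.toℕ-injective (+-cancelˡ-≡ a _ _ (begin
      a + toℕ j    ≡⟨ proj₂ (proj₂ (realised j)) ⟨
      col x (g j)  ≡⟨ cong (col x) eq ⟩
      col x (g j′) ≡⟨ proj₂ (proj₂ (realised j′)) ⟩
      a + toℕ j′   ∎))
      where open ≡-Reasoning

unflatten : ∀ {N} (r : Fin N → ℕ) → Fin (∑[ i < N ] r i) → Σ (Fin N) (λ i → Fin (r i))
unflatten {suc N} r x with splitAt (r fzero) x
... | inj₁ p = fzero , p
... | inj₂ q with unflatten (r ∘ fsuc) q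
...   | i , p = fsuc i , p

flatten : ∀ {N} (r : Fin N → ℕ) → Σ (Fin N) (λ i → Fin (r i)) → Fin (∑[ i < N ] r i)
flatten {suc N} r (fzero  , p) = p ↑ˡ ∑[ i < N ] r (fsuc i)
flatten {suc N} r (fsuc i , p) = r fzero ↑ʳ flatten (r ∘ fsuc) (i , p)

flatten-unflatten : ∀ {N} (r : Fin N → ℕ) x → flatten r (unflatten r x) ≡ x
flatten-unflatten {suc N} r x
  with splitAt (r fzero) x | FinP.join-splitAt (r fzero) (∑[ i < N ] r (fsuc i)) x
... | inj₁ p | joined = joined
... | inj₂ q | joined with unflatten (r ∘ fsuc) q | flatten-unflatten (r ∘ fsuc) q
...   | i , p | back = trans (cong (r fzero ↑ʳ_) back) joined

unflatten-injective : ∀ {N} (r : Fin N → ℕ) → Injective _≡_ _≡_ (unflatten r)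
unflatten-injective r {x} {y} eq = begin
  x                          ≡⟨ flatten-unflatten r x ⟨
  flatten r (unflatten r x)  ≡⟨ cong (flatten r) eq ⟩
  flatten r (unflatten r y)  ≡⟨ flatten-unflatten r y ⟩
  y                          ∎
  where open ≡-Reasoning

module ErdStructure {n : ℕ} (P : ProjectivePlane n) (r : Fin (PPsize n) → ℕ) where
  N : ℕ
  N = PPsize n

  V : Set
  V = ErdV N r

  points-on : Fin N → List (Fin N)
  points-on i = filter (λ k → T? (incid P k i)) (allFin N)

  lines-through : Fin N → List (Fin N)
  lines-through k = filter (λ i → T? (incid P k i)) (allFin N)

  pointLoad : Fin N → ℕ
  pointLoad k = sum (map r (lines-through k))

  line-nbrs : Fin N → List V
  line-nbrs i = u ∷ map pt (points-on i)

  line-nbrs-cover : ∀ i p y → T (erdAdj P r (vtx i p) y) → y ∈ line-nbrs i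
  line-nbrs-cover i p u         _  = Any.here refl
  line-nbrs-cover i p (pt k)    ki =
    Any.there (∈-map⁺ pt (∈-filter⁺ (λ k → T? (incid P k i)) (∈-allFin k) ki))

  line-nbrs-length : ∀ i → length (line-nbrs i) ≡ suc (suc n)
  line-nbrs-length i = cong suc (trans (length-map pt (points-on i)) (line-deg P i))

  block : Fin N → List V
  block i = map (vtx i) (allFin (r i))

  point-nbrs : Fin N → List V
  point-nbrs k = concatMap block (lines-through k)

  point-nbrs-cover : ∀ k y → T (erdAdj P r (pt k) y) → y ∈ point-nbrs k
  point-nbrs-cover k (vtx i p) ki = ∈-concatMap⁺ block
    (Any.map (λ { refl → ∈-map⁺ (vtx i) (∈-allFin p) })
             (∈-filter⁺ (λ i → T? (incid P k i)) (∈-allFin i) ki))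

  point-nbrs-length : ∀ k → length (point-nbrs k) ≡ pointLoad k
  point-nbrs-length k = trans (length-concatMap block (lines-through k))
    (cong sum (map-cong block-length (lines-through k)))
    where
    block-length : ∀ i → length (block i) ≡ r i
    block-length i =
      trans (length-map (vtx {N} {r} i) (allFin (r i))) (length-tabulate {n = r i} id)

  -- A point lies on n+1 lines, so for non-increasing r its degree is at most
  -- the sum of the n+1 largest r_i.
  pointLoad≤prefixSum : Nonincreasing r → ∀ k → pointLoad k ≤ prefixSum (suc n) r
  pointLoad≤prefixSum dec k =
    subst (_≤ prefixSum (suc n) r) (sym (sum-filter-allFin on-k r))
      (selected≤prefixSum (suc n) r (λ i → does (on-k i)) dec (≤-reflexive (begin
        ∑[ i < N ] weight (does (on-k i)) 1     ≡⟨ sum-filter-allFin on-k (λ _ → 1) ⟨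
        sum (map (λ _ → 1) (lines-through k))  ≡⟨ length-as-sum (lines-through k) ⟨
        length (lines-through k)               ≡⟨ point-deg P k ⟩
        suc n                                  ∎)))
    where
    open ≡-Reasoning
    on-k : Decidable (λ i → T (incid P k i))
    on-k i = T? (incid P k i)

  point-on-line : ∀ i → ∃[ k ] T (incid P k i)
  point-on-line i with points-on i in eq | line-deg P i  -- the list is non-empty
  ... | k ∷ _ | _ = k , proj₂ (∈-filter⁻ (λ k → T? (incid P k i)) {xs = allFin N}
                                  (subst (k ∈_) (sym eq) (Any.here refl)))

  meeting-point : ∀ i i′ → ∃[ k ] (T (incid P k i) × T (incid P k i′))
  meeting-point i i′ with i FinP.≟ i′
  ... | yes refl = let k , ki = point-on-line i in k , ki , ki
  ... | no  i≢i′ = let k , ki , ki′ , _ = two-lines P i i′ i≢i′ in k , ki , ki′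

  u-nbr : Fin (∑[ i < N ] r i) → V
  u-nbr x = vtx (proj₁ (unflatten r x)) (proj₂ (unflatten r x))

  u-nbr-injective : Injective _≡_ _≡_ u-nbr
  u-nbr-injective {x} {y} eq = unflatten-injective r (vtx-injective eq)
    where
    vtx-injective : ∀ {i i′ p p′} → vtx {N} {r} i p ≡ vtx i′ p′ → (i , p) ≡ (i′ , p′)
    vtx-injective refl = refl

<-window-trans : ∀ {x y z} p q → x < y + p → y < z + suc q → x < z + (q + p)
<-window-trans {x} {y} {z} p q x<y+p y<z+1+q = begin-strict
  x            <⟨ x<y+p ⟩
  y + p        ≤⟨ +-monoˡ-≤ p (s≤s⁻¹ (subst (suc y ≤_) (+-suc z q) y<z+1+q)) ⟩
  z + q + p    ≡⟨ +-assoc z q p ⟩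
  z + (q + p)  ∎
  where open ≤-Reasoning

module ErdColouring {n : ℕ} (P : ProjectivePlane n) (r : Fin (PPsize n) → ℕ)
                    (dec : Nonincreasing r) {t : ℕ} (C : IntervalColoring (Erd P r) t) where
  open ErdStructure P r
  open IntervalColoring C

  -- Any two colours at u differ by less than H + 2(n+1), H = r₁ + ⋯ + r_{n+1}:
  -- follow u – v – k – v′ – u through a point k common to the lines of v, v′.
  u-colours-close : ∀ i p i′ p′ →
    col u (vtx i′ p′) < col u (vtx i p) + (prefixSum (suc n) r + 2 * (n + 1))
  u-colours-close i p i′ p′ = begin-strict
    col u v′                                    <⟨ walk ⟩
    col u v + ((n + pointLoad k) + suc (suc n)) ≡⟨ cong (col u v +_) (rearrange n (pointLoad k)) ⟩
    col u v + (pointLoad k + 2 * (n + 1))       ≤⟨ +-monoʳ-≤ (col u v)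
                                                     (+-monoˡ-≤ _ (pointLoad≤prefixSum dec k)) ⟩
    col u v + (prefixSum (suc n) r + 2 * (n + 1)) ∎
    where
    open ≤-Reasoning
    v v′ : V
    v  = vtx i p
    v′ = vtx i′ p′
    k : Fin N
    k = proj₁ (meeting-point i i′)
    kv : T (incid P k i)
    kv = proj₁ (proj₂ (meeting-point i i′))
    kv′ : T (incid P k i′)
    kv′ = proj₂ (proj₂ (meeting-point i i′))

    at-v′ : col u v′ < col (pt k) v′ + suc (suc n)
    at-v′ = subst₂ _<_ (sym (col-sym u v′ tt))
      (cong₂ _+_ (col-sym v′ (pt k) kv′) (line-nbrs-length i′))
      (colour-window C v′ (line-nbrs i′) (line-nbrs-cover i′ p′) (pt k) u kv′ tt)

    at-k : col (pt k) v′ < col (pt k) v + pointLoad k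
    at-k = subst (col (pt k) v′ <_) (cong (col (pt k) v +_) (point-nbrs-length k))
      (colour-window C (pt k) (point-nbrs k) (point-nbrs-cover k) v v′ kv kv′)

    at-v : col (pt k) v < col u v + suc (suc n)
    at-v = subst₂ _<_ (col-sym v (pt k) kv)
      (cong₂ _+_ (col-sym v u tt) (line-nbrs-length i))
      (colour-window C v (line-nbrs i) (line-nbrs-cover i p) u (pt k) tt kv)

    walk : col u v′ < col u v + ((n + pointLoad k) + suc (suc n))
    walk = <-window-trans (suc (suc n)) (n + pointLoad k) at-v′
             (<-window-trans (pointLoad k) (suc n) at-k at-v)

    rearrange : ∀ m L → (m + L) + suc (suc m) ≡ L + 2 * (m + 1)
    rearrange = solve 2 (λ m L → (m :+ L) :+ (con 2 :+ m) := L :+ con 2 :* (m :+ con 1)) refl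
      where open +-*-Solver

  u-colours-injective : Injective _≡_ _≡_ (col u ∘ u-nbr)
  u-colours-injective {x} {y} eq with x FinP.≟ y
  ... | yes x≡y = x≡y
  ... | no  x≢y = contradiction eq (proper u (u-nbr x) (u-nbr y) tt tt (x≢y ∘ u-nbr-injective))

total-split : ∀ n (r : Fin (PPsize n) → ℕ) →
  ∑[ i < PPsize n ] r i ≡ prefixSum (suc n) r + tailSum n r
total-split n r = trans (∑-split (suc n) r)
  (cong (prefixSum (suc n) r +_) (sym (sum-filter-allFin (λ i → suc n ≤? toℕ i) r)))

theorem7 : (n : ℕ) → 2 ≤ n → (P : ProjectivePlane n) →
    (r : Fin (PPsize n) → ℕ) →
    (∀ i j → i ≤ᶠ j → r j ≤ r i) → (∀ i → 1 ≤ r i) →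
    tailSum n r > 2 * (n + 1) →
    ¬ InN (Erd P r)
theorem7 n _ P r dec _ tail-large (t , _ , C) = <-irrefl refl (begin-strict
  D                      ≤⟨ width ⟩
  H + 2 * (n + 1)        <⟨ +-monoʳ-< H tail-large ⟩
  H + tailSum n r        ≡⟨ total-split n r ⟨
  D                      ∎)
  where
  open ErdStructure P r
  open ErdColouring P r dec C
  open ≤-Reasoning
  D H : ℕ
  D = ∑[ i < N ] r i
  H = prefixSum (suc n) r

  width : D ≤ H + 2 * (n + 1)
  width = injective-width _ (IntervalColoring.col C u ∘ u-nbr) u-colours-injective
    λ _ _ → u-colours-close _ _ _ _
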